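{- Let $A$ be a parallel maximum-finding algorithm in Valiant's parallel comparison model with $O(f(n))$ span (number of parallel comparison steps) and $O(g(n))$ work (total number of comparisons). Then, using $A$, one can find the root $r$ of an unknown rooted tree $T=(V,E,r)$ with $|V|=n$ using path queries, with $O(f(n))$ rounds and $O(g(n)+n)$ total queries.
   Context: A rooted tree $T=(V,E,r)$ is an arborescence: a directed graph with root $r$ such that for every non-root vertex $v$ there is exactly one directed path from $r$ to $v$. A path query $path(u,v)$ returns $1$ if there is a directed path from $u$ to $v$ in $T$ and $0$ otherwise. The querier knows only $V$. Queries are issued in rounds; queries in one round are mutually independent (each may depend only on answers from previous rounds). Valiant's parallel model counts only comparison steps: in each parallel step, the algorithm performs a batch of independent comparisons between pairs of elements of a totally ordered set. -}

module Defs where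

open import Data.Nat using (ℕ; zero; suc; _+_; _*_; _≤_; _<_)
open import Data.Fin using (Fin)
open import Data.Bool using (Bool; true)
open import Data.Vec using (Vec; map)
open import Data.Product using (_×_; _,_; ∃)
open import Function using (_∘_)
open import Function.Definitions using (Injective)
open import Relation.Binary.PropositionalEquality using (_≡_)

-- Each internal node is one parallel step / round: a batch of k
-- independent queries (pairs of elements); the next step may depend on
-- the vector of all k answers.
-- The same model is used for comparison algorithms (query (u,v) asks
-- "u < v?") and for path-query algorithms (query (u,v) asks path(u,v)).

data PAlg (n : ℕ) : Set where
  leaf : Fin n → PAlg n
  node : (k : ℕ) → Vec (Fin n × Fin n) k → (Vec Bool k → PAlg n) → PAlg n

Oracle : ℕ → Set
Oracle n = Fin n → Fin n → Bool

answers : ∀ {n k} → Oracle n → Vec (Fin n × Fin n) k → Vec Bool k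
answers O = map (λ { (u , v) → O u v })

run : ∀ {n} → PAlg n → Oracle n → Fin n
run (leaf x) O = x
run (node k qs next) O = run (next (answers O qs)) O

rounds : ∀ {n} → PAlg n → Oracle n → ℕ
rounds (leaf x) O = 0
rounds (node k qs next) O = suc (rounds (next (answers O qs)) O)

queries : ∀ {n} → PAlg n → Oracle n → ℕ
queries (leaf x) O = 0
queries (node k qs next) O = k + queries (next (answers O qs)) O

-- Comparison model: the input is a totally ordered set of n distinct
-- elements, encoded by an injective key σ : Fin n → ℕ.

CmpOracle : ∀ {n} → (Fin n → ℕ) → Oracle n → Set
CmpOracle σ O = ∀ u v → (O u v ≡ true → σ u < σ v) × (σ u < σ v → O u v ≡ true)

IsMax : ∀ {n} → (Fin n → ℕ) → Fin n → Set
IsMax σ x = ∀ y → σ y ≤ σ x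

-- A correctly finds the maximum of every totally ordered n-element set
-- (here indexed so that A n works on suc n elements).
MaxFinder : ((n : ℕ) → PAlg (suc n)) → Set
MaxFinder A = ∀ n (σ : Fin (suc n) → ℕ) → Injective _≡_ _≡_ σ →
  ∀ (O : Oracle (suc n)) → CmpOracle σ O → IsMax σ (run (A n) O)

-- Rooted trees (arborescences) on vertex set Fin n, given by a root and
-- a parent map; the edges are (parent v , v) for v ≠ root.  Every vertex
-- reaches the root by iterating parent, so the graph is an arborescence.

iter : ∀ {A : Set} → (A → A) → ℕ → A → A
iter f zero x = x
iter f (suc k) x = f (iter f k x)

record RTree (n : ℕ) : Set where
  field
    root     : Fin n
    parent   : Fin n → Fin n
    root-fix : parent root ≡ root
    reach    : ∀ v → ∃ λ k → iter parent k v ≡ root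

-- there is a directed path from u to v (u is an ancestor of v, u = v allowed)
Path : ∀ {n} → RTree n → Fin n → Fin n → Set
Path T u v = ∃ λ k → iter (RTree.parent T) k v ≡ u

PathOracle : ∀ {n} → RTree n → Oracle n → Set
PathOracle T O = ∀ u v → (O u v ≡ true → Path T u v) × (Path T u v → O u v ≡ true)

SpanWorkMax : ((n : ℕ) → PAlg (suc n)) → (ℕ → ℕ) → (ℕ → ℕ) → Set
SpanWorkMax A f g = ∃ λ c → ∃ λ n₀ → ∀ n → n₀ ≤ suc n →
  ∀ (σ : Fin (suc n) → ℕ) → Injective _≡_ _≡_ σ →
  ∀ (O : Oracle (suc n)) → CmpOracle σ O →
  rounds (A n) O ≤ c * f (suc n) × queries (A n) O ≤ c * g (suc n)

RootFinder : ((n : ℕ) → PAlg (suc n)) → Set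
RootFinder B = ∀ n (T : RTree (suc n)) (O : Oracle (suc n)) → PathOracle T O →
  run (B n) O ≡ RTree.root T

RoundsQueriesRoot : ((n : ℕ) → PAlg (suc n)) → (ℕ → ℕ) → (ℕ → ℕ) → Set
RoundsQueriesRoot B f g = ∃ λ c → ∃ λ n₀ → ∀ n → n₀ ≤ suc n →
  ∀ (T : RTree (suc n)) (O : Oracle (suc n)) → PathOracle T O →
  rounds (B n) O ≤ c * f (suc n) × queries (B n) O ≤ c * (g (suc n) + suc n)

module Submission where

-- Root finding by path queries, reduced to maximum finding by comparisons.
--
-- Let A find the maximum of N totally ordered elements.  On a tree T with
-- N vertices, one of them called v₀, the algorithm B first spends one round
-- of N queries path(v , v₀), learning which vertices lie on the spine, the
-- path from the root down to v₀.  It then runs A, answering every comparison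
-- "u < v ?" from the single path query path(v , u):
--   * off-spine vertices are ordered by index and lie below the spine,
--   * on the spine, u < v iff u is a proper descendant of v.
-- This is a genuine total order: it is the order of the injective key σ
-- that sends an off-spine v to its index and a spine vertex k parent steps
-- above v₀ to N + k.  Its maximum is the root, which B outputs.

open import Defs
open import Data.Nat using (ℕ; zero; suc; _+_; _*_; _∸_; _≤_; _<_; _<ᵇ_; _⊔_; z≤n; s≤s; >-nonZero)
open import Data.Nat.Properties hiding (_≟_)
open import Data.Fin using (Fin; toℕ; fromℕ; opposite; _≟_) renaming (zero to v₀)
open import Data.Fin.Properties using (toℕ-injective; toℕ<n; toℕ-fromℕ; opposite-prop; opposite-involutive)
open import Data.Bool using (Bool; true; false; _∧_; not)
open import Data.Bool.Properties using (T-≡)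
open import Data.Vec using (Vec; []; _∷_; map; zipWith; lookup; tabulate)
open import Data.Vec.Properties using (lookup-map; lookup∘tabulate)
open import Data.Product using (Σ; Σ-syntax; _×_; _,_; proj₁; proj₂; swap; uncurry; ∃)
open import Data.Empty using (⊥; ⊥-elim)
open import Function using (_∘_; Equivalence)
open import Function.Definitions using (Injective)
open import Relation.Nullary using (¬_; yes; no; does; contradiction)
open import Relation.Binary.PropositionalEquality

Decides : Bool → Set → Set
Decides b P = (b ≡ true → P) × (P → b ≡ true)

decides-true : ∀ {P} → P → Decides true P
decides-true p = (λ _ → p) , (λ _ → refl)

decides-false : ∀ {P} → ¬ P → Decides false P
decides-false ¬p = (λ ()) , (λ p → contradiction p ¬p)

decides-∧ : ∀ {a b P Q} → Decides a P → Decides b Q → Decides (a ∧ b) (P × Q)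
decides-∧ {true}  (a⇒P , P⇒a) (b⇒Q , Q⇒b) = (λ b≡t → a⇒P refl , b⇒Q b≡t) , (λ (p , q) → Q⇒b q)
decides-∧ {false} (a⇒P , P⇒a) _            = (λ ()) , (λ (p , _) → P⇒a p)

decides-≢ : ∀ {n} (u v : Fin n) → Decides (not (does (u ≟ v))) (u ≢ v)
decides-≢ u v with u ≟ v
... | yes u≡v = decides-false (λ u≢v → u≢v u≡v)
... | no  u≢v = decides-true u≢v

<ᵇ-decides : ∀ m n → Decides (m <ᵇ n) (m < n)
<ᵇ-decides m n = (<ᵇ⇒< m n ∘ Equivalence.from T-≡) , (Equivalence.to T-≡ ∘ <⇒<ᵇ)

iter-+ : ∀ {A : Set} (f : A → A) m k x → iter f (m + k) x ≡ iter f m (iter f k x)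
iter-+ f zero    k x = refl
iter-+ f (suc m) k x = cong f (iter-+ f m k x)

iter-split : ∀ {A : Set} (f : A → A) {k l} x → k ≤ l → iter f l x ≡ iter f (l ∸ k) (iter f k x)
iter-split f {k} {l} x k≤l = begin
  iter f l x                   ≡⟨ cong (λ t → iter f t x) (sym (m∸n+n≡m k≤l)) ⟩
  iter f ((l ∸ k) + k) x       ≡⟨ iter-+ f (l ∸ k) k x ⟩
  iter f (l ∸ k) (iter f k x)  ∎
  where open ≡-Reasoning

iter-periodic : ∀ {A : Set} (f : A → A) p x → iter f p x ≡ x → ∀ m → iter f (m * p) x ≡ x
iter-periodic f p x per zero    = refl
iter-periodic f p x per (suc m) = begin
  iter f (p + m * p) x         ≡⟨ iter-+ f p (m * p) x ⟩
  iter f p (iter f (m * p) x)  ≡⟨ cong (iter f p) (iter-periodic f p x per m) ⟩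
  iter f p x                   ≡⟨ per ⟩
  x                            ∎
  where open ≡-Reasoning

module TreeFacts {N : ℕ} (T : RTree N) where
  open RTree T

  iter-root : ∀ j → iter parent j root ≡ root
  iter-root zero    = refl
  iter-root (suc j) = trans (cong parent (iter-root j)) root-fix

  stays-at-root : ∀ {k j} v → iter parent k v ≡ root → k ≤ j → iter parent j v ≡ root
  stays-at-root {k} {j} v at-root k≤j = begin
    iter parent j v                        ≡⟨ iter-split parent v k≤j ⟩
    iter parent (j ∸ k) (iter parent k v)  ≡⟨ cong (iter parent (j ∸ k)) at-root ⟩
    iter parent (j ∸ k) root               ≡⟨ iter-root (j ∸ k) ⟩
    root                                   ∎
    where open ≡-Reasoning

  cycle⇒root : ∀ p v → iter parent (suc p) v ≡ v → v ≡ root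
  cycle⇒root p v cyc = begin
    v                                ≡⟨ sym (iter-periodic parent (suc p) v cyc k) ⟩
    iter parent (k * suc p) v        ≡⟨ stays-at-root v (proj₂ (reach v)) (m≤m*n k (suc p)) ⟩
    root                             ∎
    where
      open ≡-Reasoning
      k = proj₁ (reach v)

  path-antisym : ∀ {u v} → Path T u v → Path T v u → u ≡ v
  path-antisym {u} {v} (a , v↑a≡u) (b , u↑b≡v) with b + a in b+a≡
  ... | zero  = trans (sym v↑a≡u) (cong (λ t → iter parent t v) (m+n≡0⇒n≡0 b b+a≡))
  ... | suc p = begin
      u                   ≡⟨ sym v↑a≡u ⟩
      iter parent a v     ≡⟨ cong (iter parent a) v≡root ⟩
      iter parent a root  ≡⟨ iter-root a ⟩
      root                ≡⟨ sym v≡root ⟩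
      v                   ∎
    where
      open ≡-Reasoning
      v≡root : v ≡ root
      v≡root = cycle⇒root p v (begin
        iter parent (suc p) v            ≡⟨ cong (λ t → iter parent t v) (sym b+a≡) ⟩
        iter parent (b + a) v            ≡⟨ iter-+ parent b a v ⟩
        iter parent b (iter parent a v)  ≡⟨ cong (iter parent b) v↑a≡u ⟩
        iter parent b u                  ≡⟨ u↑b≡v ⟩
        v                                ∎)

  walk-path : ∀ x {k l} → k ≤ l → Path T (iter parent l x) (iter parent k x)
  walk-path x {k} {l} k≤l = l ∸ k , sym (iter-split parent x k≤l)

  walk-strict : ∀ x k l → Path T (iter parent l x) (iter parent k x) →
                iter parent k x ≢ iter parent l x → k < l
  walk-strict x k l l-above-k k≢l with k <? l
  ... | yes k<l = k<l
  ... | no  k≮l = contradiction (path-antisym (walk-path x (≮⇒≥ k≮l)) l-above-k) k≢l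

reduce : ∀ {N} → (Fin N × Fin N → Fin N × Fin N) → (Fin N × Fin N → Bool → Bool) →
         Oracle N → Oracle N
reduce q post O u v = post (u , v) (O (proj₁ (q (u , v))) (proj₂ (q (u , v))))

simulate : ∀ {N} → (Fin N × Fin N → Fin N × Fin N) → (Fin N × Fin N → Bool → Bool) →
           PAlg N → PAlg N
simulate q post (leaf x)         = leaf x
simulate q post (node k qs next) =
  node k (map q qs) (λ as → simulate q post (next (zipWith post qs as)))

module Simulation {N : ℕ} (q : Fin N × Fin N → Fin N × Fin N) (post : Fin N × Fin N → Bool → Bool)
                  (O : Oracle N) where

  answers-reduce : ∀ {k} (qs : Vec (Fin N × Fin N) k) →
                   zipWith post qs (answers O (map q qs)) ≡ answers (reduce q post O) qs
  answers-reduce []        = refl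
  answers-reduce (p ∷ qs)  = cong (_ ∷_) (answers-reduce qs)

  run-simulate : ∀ A → run (simulate q post A) O ≡ run A (reduce q post O)
  run-simulate (leaf x) = refl
  run-simulate (node k qs next) rewrite answers-reduce qs = run-simulate (next _)

  rounds-simulate : ∀ A → rounds (simulate q post A) O ≡ rounds A (reduce q post O)
  rounds-simulate (leaf x) = refl
  rounds-simulate (node k qs next) rewrite answers-reduce qs = cong suc (rounds-simulate (next _))

  queries-simulate : ∀ A → queries (simulate q post A) O ≡ queries A (reduce q post O)
  queries-simulate (leaf x) = refl
  queries-simulate (node k qs next) rewrite answers-reduce qs = cong (k +_) (queries-simulate (next _))

-- "u < v ?" given the spine memberships of u and v and the answer to path(v , u).
spineLess : ∀ {N} → Bool → Bool → Fin N → Fin N → Bool → Bool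
spineLess true  true  u v v-above-u = v-above-u ∧ not (does (u ≟ v))
spineLess true  false u v _         = false
spineLess false true  u v _         = true
spineLess false false u v _         = toℕ u <ᵇ toℕ v

spineCmp : ∀ {N} → (Fin N → Bool) → Fin N × Fin N → Bool → Bool
spineCmp onSpine (u , v) = spineLess (onSpine u) (onSpine v) u v

spineQueries : ∀ n → Vec (Fin (suc n) × Fin (suc n)) (suc n)
spineQueries n = tabulate (λ v → v , v₀)

rootFinder : ((n : ℕ) → PAlg (suc n)) → (n : ℕ) → PAlg (suc n)
rootFinder A n =
  node (suc n) (spineQueries n) (λ onSpine → simulate swap (spineCmp (lookup onSpine)) (A n))

spine-answers : ∀ {n} (O : Oracle (suc n)) v → lookup (answers O (spineQueries n)) v ≡ O v v₀
spine-answers {n} O v =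
  trans (lookup-map v _ (spineQueries n)) (cong (uncurry O) (lookup∘tabulate (λ u → u , v₀) v))

module SpineOrder {n : ℕ} (T : RTree (suc n)) (O : Oracle (suc n)) (isPath : PathOracle T O)
                  (onSpine : Fin (suc n) → Bool) (onSpine-spec : ∀ v → onSpine v ≡ O v v₀) where
  open RTree T
  open TreeFacts T

  N : ℕ
  N = suc n

  cmp : Oracle N
  cmp = reduce swap (spineCmp onSpine) O

  cmp-at : ∀ {u v b c} → onSpine u ≡ b → onSpine v ≡ c → cmp u v ≡ spineLess b c u v (O v u)
  cmp-at {u} {v} = cong₂ (λ b c → spineLess b c u v (O v u))

  spine-height : ∀ v → onSpine v ≡ true → ∃ λ k → iter parent k v₀ ≡ v
  spine-height v on = proj₁ (isPath v v₀) (trans (sym (onSpine-spec v)) on)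

  data Rank (v : Fin N) (s : ℕ) : Set where
    off-spine : onSpine v ≡ false → s ≡ toℕ v → Rank v s
    on-spine  : ∀ k → iter parent k v₀ ≡ v → onSpine v ≡ true → s ≡ N + k → Rank v s

  rank : ∀ v → Σ ℕ (Rank v)
  rank v with onSpine v in on
  ... | true  = let (k , v₀↑k≡v) = spine-height v on in N + k , on-spine k v₀↑k≡v on refl
  ... | false = toℕ v , off-spine on refl

  σ : Fin N → ℕ
  σ v = proj₁ (rank v)

  rank-of : ∀ v → Rank v (σ v)
  rank-of v = proj₂ (rank v)

  off<on : ∀ u k → toℕ u < N + k
  off<on u k = <-≤-trans (toℕ<n u) (m≤m+n N k)

  -- Distinct vertices get distinct keys: indices are distinct, and two spine
  -- vertices at the same height above v₀ coincide.
  σ-injective : Injective _≡_ _≡_ σ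
  σ-injective {u} {v} σu≡σv with rank-of u | rank-of v
  ... | off-spine _ su     | off-spine _ sv     = toℕ-injective (trans (sym su) (trans σu≡σv sv))
  ... | off-spine _ su     | on-spine l _ _ sv  = contradiction (trans (sym su) (trans σu≡σv sv)) (<⇒≢ (off<on u l))
  ... | on-spine k _ _ su  | off-spine _ sv     = contradiction (trans (sym sv) (trans (sym σu≡σv) su)) (<⇒≢ (off<on v k))
  ... | on-spine k v₀↑k≡u _ su | on-spine l v₀↑l≡v _ sv = begin
      u                  ≡⟨ sym v₀↑k≡u ⟩
      iter parent k v₀   ≡⟨ cong (λ t → iter parent t v₀) (+-cancelˡ-≡ N k l (trans (sym su) (trans σu≡σv sv))) ⟩
      iter parent l v₀   ≡⟨ v₀↑l≡v ⟩
      v                  ∎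
    where open ≡-Reasoning

  spine-below : ∀ {u v k l} → iter parent k v₀ ≡ u → iter parent l v₀ ≡ v → σ u ≡ N + k → σ v ≡ N + l →
                Decides (O v u ∧ not (does (u ≟ v))) (N + k < N + l)
  spine-below {u} {v} {k} {l} v₀↑k≡u v₀↑l≡v su sv =
    (+-monoʳ-< N ∘ below⇒< ∘ proj₁ decides-below) , (proj₂ decides-below ∘ <⇒below ∘ +-cancelˡ-< N k l)
    where
      decides-below : Decides (O v u ∧ not (does (u ≟ v))) (Path T v u × u ≢ v)
      decides-below = decides-∧ (isPath v u) (decides-≢ u v)
      below⇒< : Path T v u × u ≢ v → k < l
      below⇒< (v-above-u , u≢v) =
        walk-strict v₀ k l (subst₂ (Path T) (sym v₀↑l≡v) (sym v₀↑k≡u) v-above-u)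
                    (λ k≡l → u≢v (trans (sym v₀↑k≡u) (trans k≡l v₀↑l≡v)))
      <⇒below : k < l → Path T v u × u ≢ v
      <⇒below k<l = subst₂ (Path T) v₀↑l≡v v₀↑k≡u (walk-path v₀ (<⇒≤ k<l))
                  , λ u≡v → <⇒≢ (+-monoʳ-< N k<l) (trans (sym su) (trans (cong σ u≡v) sv))

  as-keys : ∀ {u v b c s t} → onSpine u ≡ b → onSpine v ≡ c → σ u ≡ s → σ v ≡ t →
            Decides (spineLess b c u v (O v u)) (s < t) → Decides (cmp u v) (σ u < σ v)
  as-keys ou ov su sv = subst₂ Decides (sym (cmp-at ou ov)) (sym (cong₂ _<_ su sv))

  cmp-correct : CmpOracle σ cmp
  cmp-correct u v with rank-of u | rank-of v
  ... | off-spine ou su | off-spine ov sv = as-keys ou ov su sv (<ᵇ-decides (toℕ u) (toℕ v))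
  ... | off-spine ou su | on-spine l _ ov sv = as-keys ou ov su sv (decides-true (off<on u l))
  ... | on-spine k _ ou su | off-spine ov sv = as-keys ou ov su sv (decides-false (<⇒≯ (off<on v k)))
  ... | on-spine k v₀↑k≡u ou su | on-spine l v₀↑l≡v ov sv =
        as-keys ou ov su sv (spine-below v₀↑k≡u v₀↑l≡v su sv)

  root-on-spine : onSpine root ≡ true
  root-on-spine = trans (onSpine-spec root) (proj₂ (isPath root v₀) (reach v₀))

  below-root : ∀ x → x ≢ root → cmp x root ≡ true
  below-root x x≢root = by-membership (onSpine x) refl
    where
      by-membership : ∀ b → onSpine x ≡ b → cmp x root ≡ true
      by-membership false ox = cmp-at ox root-on-spine
      by-membership true  ox = trans (cmp-at ox root-on-spine)
        (cong₂ _∧_ (proj₂ (isPath root x) (reach x)) (proj₂ (decides-≢ x root) x≢root))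

  max-is-root : ∀ x → IsMax σ x → x ≡ root
  max-is-root x x-max with x ≟ root
  ... | yes x≡root = x≡root
  ... | no  x≢root = contradiction (x-max root) (<⇒≱ (proj₁ (cmp-correct x root) (below-root x x≢root)))

module RootFinderOnTree (A : (n : ℕ) → PAlg (suc n)) {n : ℕ} (T : RTree (suc n))
                        (O : Oracle (suc n)) (isPath : PathOracle T O) where
  open SpineOrder T O isPath (lookup (answers O (spineQueries n))) (spine-answers O) public
  open Simulation swap (spineCmp (lookup (answers O (spineQueries n)))) O

  run-rootFinder : run (rootFinder A n) O ≡ run (A n) cmp
  run-rootFinder = run-simulate (A n)

  rounds-rootFinder : rounds (rootFinder A n) O ≡ suc (rounds (A n) cmp)
  rounds-rootFinder = cong suc (rounds-simulate (A n))

  queries-rootFinder : queries (rootFinder A n) O ≡ suc n + queries (A n) cmp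
  queries-rootFinder = cong (suc n +_) (queries-simulate (A n))

no-common-max : ∀ {n} (x : Fin (suc (suc n))) → IsMax toℕ x → IsMax (toℕ ∘ opposite) x → ⊥
no-common-max {n} x x-max x-max-reversed = <⇒≱ (s≤s z≤n) (begin
    suc n                            ≡⟨ sym (opposite-prop {suc (suc n)} v₀) ⟩
    toℕ (opposite {suc (suc n)} v₀)  ≤⟨ x-max-reversed v₀ ⟩
    toℕ (opposite x)                 ≡⟨ opposite-prop x ⟩
    suc n ∸ toℕ x                    ≡⟨ m≤n⇒m∸n≡0 x-last ⟩
    0                                ∎)
  where
    open ≤-Reasoning
    x-last : suc n ≤ toℕ x
    x-last = subst (_≤ toℕ x) (toℕ-fromℕ (suc n)) (x-max (fromℕ (suc n)))

reversed-key-injective : ∀ {n} → Injective _≡_ _≡_ (toℕ ∘ opposite {n})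
reversed-key-injective {_} {i} {j} same = begin
  i                        ≡⟨ sym (opposite-involutive i) ⟩
  opposite (opposite i)    ≡⟨ cong opposite (toℕ-injective same) ⟩
  opposite (opposite j)    ≡⟨ opposite-involutive j ⟩
  j                        ∎
  where open ≡-Reasoning

maxFinder-rounds : (A : (n : ℕ) → PAlg (suc n)) → MaxFinder A → ∀ n O → 1 ≤ rounds (A (suc n)) O
maxFinder-rounds A finds n O with A (suc n) in A≡
... | leaf x = ⊥-elim (no-common-max x (leaf-max toℕ toℕ-injective) (leaf-max _ reversed-key-injective))
  where
    leaf-max : ∀ σ → Injective _≡_ _≡_ σ → IsMax σ x
    leaf-max σ σ-inj = subst (λ a → IsMax σ (run a (λ u v → σ u <ᵇ σ v))) A≡
                         (finds (suc n) σ σ-inj _ (λ u v → <ᵇ-decides (σ u) (σ v)))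
... | node _ _ _ = s≤s z≤n

positive-factor : ∀ {r} c F → 1 ≤ r → r ≤ c * F → 1 ≤ c
positive-factor zero    F 1≤r r≤0 = ⊥-elim (<⇒≱ 1≤r r≤0)
positive-factor (suc c) F _   _   = s≤s z≤n

rounds-bound : ∀ {r} c F → 1 ≤ r → r ≤ c * F → suc r ≤ (c + c) * F
rounds-bound {r} c F 1≤r r≤cF = begin
  1 + r          ≤⟨ +-monoˡ-≤ r 1≤r ⟩
  r + r          ≤⟨ +-mono-≤ r≤cF r≤cF ⟩
  c * F + c * F  ≡⟨ sym (*-distribʳ-+ F c c) ⟩
  (c + c) * F    ∎
  where open ≤-Reasoning

queries-bound : ∀ {q} c G N → 1 ≤ c → q ≤ c * G → N + q ≤ (c + c) * (G + N)
queries-bound {q} c G N 1≤c q≤cG = begin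
  N + q                      ≤⟨ +-mono-≤ (m≤n*m N c ⦃ >-nonZero 1≤c ⦄) q≤cG ⟩
  c * N + c * G              ≡⟨ +-comm (c * N) (c * G) ⟩
  c * G + c * N              ≡⟨ sym (*-distribˡ-+ c G N) ⟩
  c * (G + N)                ≤⟨ m≤m+n (c * (G + N)) (c * (G + N)) ⟩
  c * (G + N) + c * (G + N)  ≡⟨ sym (*-distribʳ-+ (G + N) c c) ⟩
  (c + c) * (G + N)          ∎
  where open ≤-Reasoning

-- With the constant 2c and threshold max(n₀, 2), the root finder built
-- from A finds the root in O(f) rounds and O(g + n) queries.
lemma9 : (f g : ℕ → ℕ) (A : (n : ℕ) → PAlg (suc n)) →
    MaxFinder A → SpanWorkMax A f g →
    Σ[ B ∈ ((n : ℕ) → PAlg (suc n)) ] (RootFinder B × RoundsQueriesRoot B f g)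
lemma9 f g A finds (c , n₀ , A-cost) = rootFinder A , finds-root , (c + c , n₀ ⊔ 2 , cost)
  where
    finds-root : RootFinder (rootFinder A)
    finds-root n T O isPath =
      trans run-rootFinder (max-is-root _ (finds n σ σ-injective cmp cmp-correct))
      where open RootFinderOnTree A T O isPath

    cost : ∀ n → n₀ ⊔ 2 ≤ suc n → ∀ (T : RTree (suc n)) (O : Oracle (suc n)) → PathOracle T O →
           rounds (rootFinder A n) O ≤ (c + c) * f (suc n) ×
           queries (rootFinder A n) O ≤ (c + c) * (g (suc n) + suc n)
    cost zero    large T O isPath = ⊥-elim (<⇒≱ (s≤s (s≤s z≤n)) (≤-trans (m≤n⊔m n₀ 2) large))
    cost (suc n) large T O isPath =
        ≤-trans (≤-reflexive rounds-rootFinder) (rounds-bound c (f (suc (suc n))) one-round (proj₁ bound))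
      , ≤-trans (≤-reflexive queries-rootFinder)
                (queries-bound c (g (suc (suc n))) (suc (suc n)) c-positive (proj₂ bound))
      where
        open RootFinderOnTree A T O isPath
        bound : rounds (A (suc n)) cmp ≤ c * f (suc (suc n)) × queries (A (suc n)) cmp ≤ c * g (suc (suc n))
        bound = A-cost (suc n) (≤-trans (m≤m⊔n n₀ 2) large) σ σ-injective cmp cmp-correct
        one-round : 1 ≤ rounds (A (suc n)) cmp
        one-round = maxFinder-rounds A finds n cmp
        c-positive : 1 ≤ c
        c-positive = positive-factor c (f (suc (suc n))) one-round (proj₁ bound)
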